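{- Let $n$ be a positive integer with $n\ne 1$ and $n\ne 3$. There exists a universal cycle for the set of illegal rankings of length $n$ over the alphabet $[n]=\{1,\dots,n\}$, i.e., the set of $n$-letter words over $[n]$ that are not legal rankings.
   Context: A word $a_1a_2\dots a_n$ over $[n]=\{1,\dots,n\}$ represents a ranking (possibly with ties) of $n$ contestants, $a_j$ being the place of contestant $j$. It is a legal ranking if for every letter $r$ occurring in the word, the number of indices $j$ with $a_j<r$ equals $r-1$ (e.g., $1413$ is legal, while $254313$ and $22$ are illegal; in particular every legal ranking contains a $1$). An illegal ranking is a word over $[n]$ of length $n$ that is not a legal ranking. For a set $\mathcal{C}$ of $n$-letter words over an alphabet, a universal cycle (U-cycle) for $\mathcal{C}$ is a cyclic sequence $x_1x_2\dots x_N$ with $N=|\mathcal{C}|$ such that the $N$ words $x_ix_{i+1}\dots x_{i+n-1}$ ($1\le i\le N$, indices taken modulo $N$) are exactly the words of $\mathcal{C}$, each occurring exactly once. -}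

module Defs where

open import Data.Nat using (ℕ; zero; suc; _+_)
open import Data.Nat.DivMod using (_mod_)
open import Data.Fin using (Fin; toℕ; _<_; _<?_)
open import Data.Vec using (Vec; tabulate; count)
open import Data.Vec.Membership.Propositional using (_∈_)
open import Data.Product using (Σ; _×_; ∃)
open import Relation.Nullary using (¬_)
open import Relation.Binary.PropositionalEquality using (_≡_)
open import Function.Definitions using (Injective)

-- Letters of the alphabet [n] = {1,…,n} are encoded as Fin n:
-- the element i : Fin n stands for the letter (toℕ i + 1).
-- An n-letter word over [n] is a Vec (Fin n) n; entry j is a_{j+1}.
Word : ℕ → Set
Word n = Vec (Fin n) n

-- Legal ranking: for every letter r occurring in the word, the number of
-- indices j with a_j < r equals r - 1 (= toℕ r in the Fin encoding).
Legal : ∀ {n} → Word n → Set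
Legal {n} w = (r : Fin n) → r ∈ w → count (_<? r) w ≡ toℕ r

Illegal : ∀ {n} → Word n → Set
Illegal w = ¬ Legal w

window : ∀ {A : Set} {M : ℕ} (n : ℕ) → (Fin (suc M) → A) → Fin (suc M) → Vec A n
window {M = M} n x i = tabulate (λ (k : Fin n) → x ((toℕ i + toℕ k) mod (suc M)))

-- x is a universal cycle for the set C of n-letter words: the N windows
-- x_i … x_{i+n-1} are exactly the words of C, each exactly once
-- (i.e. i ↦ window i is a bijection from Fin N onto C; in particular N = |C|).
UCycle : ∀ {A : Set} {M : ℕ} (n : ℕ) (C : Vec A n → Set) → (Fin (suc M) → A) → Set
UCycle n C x =
  ((i : _) → C (window n x i))
  × Injective _≡_ _≡_ (window n x)
  × ((w : _) → C w → ∃ λ i → window n x i ≡ w)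

module Submission where

-- A word of length n is an edge of the de Bruijn graph: e is followed by f
-- when f = tail e ∷ʳ b for some letter b.  A universal cycle for a set C of
-- words is the list of first letters of a closed trail that uses every word
-- of C exactly once (trail→universalCycle).  Such a trail is built by joining
-- cycles:
--   * if C is closed under rotation, the rotations of a word of C form a
--     closed trail inside C (its orbit);
--   * a closed trail through f and a disjoint closed trail through a sibling e
--     of f (tail e ≡ tail f) splice into one closed trail (splice);
--   * hence, starting from the orbit of a base word, every word of C reachable
--     from the base by rotations and sibling steps inside C can be absorbed
--     (cycleJoining, for any decidable rotation-closed C over Fin q).
-- Illegality is rotation invariant, and with the base word n n … n every
-- illegal ranking is reachable: a word containing the letter n by turning its
-- letters into n one at a time; a word without n by one sibling step to a
-- word with n, unless it is a rotation of M 1 1 … 1 (forcedShape), and such a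
-- word reaches n 1 … 1 2 through illegal words exactly when n ≠ 3.

open import Defs
open import Data.Nat as ℕ using (ℕ; zero; suc; _+_; _∸_; z≤n; s≤s)
import Data.Nat.Properties as NP
import Data.Nat.DivMod as DM
open DM using (_%_; _mod_)
open import Data.Fin as F using (Fin; toℕ; fromℕ; inject₁) renaming (zero to fz; suc to fs)
import Data.Fin.Properties as FP
open import Data.Vec as V using (Vec; []; _∷_; _∷ʳ_; toList; count; head; tail; replicate)
import Data.Vec.Properties as VP
open import Data.Vec.Relation.Unary.Any as VAny using (here; there)
import Data.Vec.Membership.Propositional as VM
import Data.Vec.Membership.Propositional.Properties as VMP
open import Data.List as L using (List; []; _∷_; _++_; [_]; length)
import Data.List.Properties as LP
import Data.List.Membership.Propositional as LM
import Data.List.Membership.Propositional.Properties as LMP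
import Data.List.Relation.Unary.Any as LAny
import Data.List.Relation.Unary.All as All
open import Data.List.Relation.Unary.All using ([]; _∷_)
open import Data.List.Relation.Unary.AllPairs using ([]; _∷_)
open import Data.List.Relation.Unary.Unique.Propositional using (Unique)
import Data.List.Relation.Unary.Unique.Propositional.Properties as UP
open import Data.List.Relation.Binary.Disjoint.Propositional using (Disjoint)
open import Data.List.Relation.Binary.Permutation.Propositional
  using (_↭_; ↭-refl; ↭-sym; ↭-trans; prep; swap; ↭⇒↭ₛ)
import Data.List.Relation.Binary.Permutation.Propositional.Properties as PP
import Data.List.Relation.Binary.Permutation.Setoid.Properties as PS
open import Data.Product using (Σ; _×_; _,_; ∃)
open import Data.Sum using (_⊎_; inj₁; inj₂)
open import Data.Empty using (⊥-elim)
open import Relation.Nullary using (¬_; Dec; yes; no; does; ¬?)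
open import Relation.Nullary.Decidable using (_→-dec_; _×-dec_)
open import Relation.Unary using (Decidable)
open import Relation.Binary.Definitions using (DecidableEquality)
open import Relation.Binary.PropositionalEquality hiding ([_])
open import Data.Bool using (true; false)
open import Function using (case_of_)

leastBelow : (P : ℕ → Set) → (∀ i → Dec (P i)) → (b : ℕ) →
             (∀ i → i ℕ.< b → ¬ P i) ⊎
             (Σ ℕ λ m → m ℕ.< b × P m × (∀ i → i ℕ.< m → ¬ P i))
leastBelow P P? zero = inj₁ (λ i ())
leastBelow P P? (suc b) with leastBelow P P? b
... | inj₂ (m , m<b , pm , below) = inj₂ (m , NP.m≤n⇒m≤1+n m<b , pm , below)
... | inj₁ none with P? b
...   | yes pb = inj₂ (b , NP.≤-refl , pb , none)
...   | no ¬pb = inj₁ λ i i<1+b → case NP.m≤n⇒m<n∨m≡n (NP.≤-pred i<1+b) of λ where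
          (inj₁ i<b)  → none i i<b
          (inj₂ refl) → ¬pb

module _ {A : Set} where

  rotL : List A → List A
  rotL []      = []
  rotL (a ∷ l) = l ++ [ a ]

  rotLN : ℕ → List A → List A
  rotLN zero    l = l
  rotLN (suc j) l = rotLN j (rotL l)

  rotLN-++ : ∀ (xs ys : List A) → rotLN (length xs) (xs ++ ys) ≡ ys ++ xs
  rotLN-++ []       ys = sym (LP.++-identityʳ ys)
  rotLN-++ (x ∷ xs) ys = begin
    rotLN (length xs) ((xs ++ ys) ++ [ x ])  ≡⟨ cong (rotLN (length xs)) (LP.++-assoc xs ys [ x ]) ⟩
    rotLN (length xs) (xs ++ ys ++ [ x ])    ≡⟨ rotLN-++ xs (ys ++ [ x ]) ⟩
    (ys ++ [ x ]) ++ xs                      ≡⟨ LP.++-assoc ys [ x ] xs ⟩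
    ys ++ x ∷ xs                             ∎
    where open ≡-Reasoning

  replicate-∷ʳ : ∀ j (x : A) → L.replicate j x ++ [ x ] ≡ L.replicate (suc j) x
  replicate-∷ʳ zero    x = refl
  replicate-∷ʳ (suc j) x = cong (x ∷_) (replicate-∷ʳ j x)

  all-equal⇒replicate : ∀ {m} c (v : Vec A m) → (∀ x → x VM.∈ v → x ≡ c) → v ≡ replicate m c
  all-equal⇒replicate c []      _   = refl
  all-equal⇒replicate c (y ∷ v) all = cong₂ _∷_ (all y (here refl)) (all-equal⇒replicate c v (λ x x∈ → all x (there x∈)))

  ∈-tail : ∀ {m r} (v : Vec A (suc m)) → r VM.∈ tail v → r VM.∈ v
  ∈-tail (a ∷ u) r∈ = there r∈

  toList-injective : ∀ {m} {x y : Vec A m} → toList x ≡ toList y → x ≡ y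
  toList-injective {x = x} {y} eq = trans (sym (VP.cast-is-id refl x)) (VP.toList-injective refl x y eq)

  ∈-∷ʳ⁺ : ∀ {m r a} (u : Vec A m) → r VM.∈ (a ∷ u) → r VM.∈ (u ∷ʳ a)
  ∈-∷ʳ⁺ []      (here p)          = here p
  ∈-∷ʳ⁺ (x ∷ u) (here p)          = there (∈-∷ʳ⁺ u (here p))
  ∈-∷ʳ⁺ (x ∷ u) (there (here p))  = here p
  ∈-∷ʳ⁺ (x ∷ u) (there (there q)) = there (∈-∷ʳ⁺ u (there q))

  module _ {P : A → Set} (P? : Decidable P) where

    count-∷ʳ : ∀ {m} (u : Vec A m) a → count P? (u ∷ʳ a) ≡ count P? (a ∷ u)
    count-∷ʳ []      a = refl
    count-∷ʳ (x ∷ u) a rewrite count-∷ʳ u a with does (P? a) | does (P? x)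
    ... | true  | true  = refl
    ... | true  | false = refl
    ... | false | true  = refl
    ... | false | false = refl

    count-yes : ∀ {m} x (v : Vec A m) → P x → count P? (x ∷ v) ≡ suc (count P? v)
    count-yes x v px with P? x
    ... | yes _  = refl
    ... | no ¬px = ⊥-elim (¬px px)

    count-no : ∀ {m} x (v : Vec A m) → ¬ P x → count P? (x ∷ v) ≡ count P? v
    count-no x v ¬px with P? x
    ... | yes px = ⊥-elim (¬px px)
    ... | no _   = refl

    count<length : ∀ {m x} (v : Vec A m) → x VM.∈ v → ¬ P x → count P? v ℕ.< m
    count<length (y ∷ v) (here refl) ¬px rewrite count-no y v ¬px = s≤s (VP.count≤n P? v)
    count<length (y ∷ v) (there x∈) ¬px with P? y
    ... | yes _ = s≤s (count<length v x∈ ¬px)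
    ... | no _  = NP.m≤n⇒m≤1+n (count<length v x∈ ¬px)

    count-witness : ∀ {m} (v : Vec A m) → 0 ℕ.< count P? v → Σ A λ x → x VM.∈ v × P x
    count-witness (y ∷ v) pos with P? y
    ... | yes py = y , here refl , py
    ... | no _ with count-witness v pos
    ...   | x , x∈ , px = x , there x∈ , px

    count-none : ∀ {m} (v : Vec A m) → (∀ x → x VM.∈ v → ¬ P x) → count P? v ≡ 0
    count-none []      none = refl
    count-none (y ∷ v) none rewrite count-no y v (none y (here refl)) =
      count-none v (λ x x∈ → none x (there x∈))

module _ {A : Set} {k : ℕ} where

  rot : Vec A (suc k) → Vec A (suc k)
  rot (a ∷ u) = u ∷ʳ a

  rotN : ℕ → Vec A (suc k) → Vec A (suc k)
  rotN zero    w = w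
  rotN (suc j) w = rotN j (rot w)

  toList-rotN : ∀ j w → toList (rotN j w) ≡ rotLN j (toList w)
  toList-rotN zero    w       = refl
  toList-rotN (suc j) (a ∷ u) = trans (toList-rotN j (u ∷ʳ a)) (cong (rotLN j) (VP.toList-∷ʳ a u))

  rotN-period : ∀ w → rotN (suc k) w ≡ w
  rotN-period w = toList-injective (begin
    toList (rotN (suc k) w)                     ≡⟨ toList-rotN (suc k) w ⟩
    rotLN (suc k) (toList w)                    ≡⟨ cong (λ j → rotLN j (toList w)) (sym (VP.length-toList w)) ⟩
    rotLN (length (toList w)) (toList w)        ≡⟨ cong (rotLN (length (toList w))) (sym (LP.++-identityʳ (toList w))) ⟩
    rotLN (length (toList w)) (toList w ++ [])  ≡⟨ rotLN-++ (toList w) [] ⟩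
    toList w                                    ∎)
    where open ≡-Reasoning

  rotN-+ : ∀ a c w → rotN (a + c) w ≡ rotN c (rotN a w)
  rotN-+ zero    c w = refl
  rotN-+ (suc a) c w = rotN-+ a c (rot w)

  rot-rotN : ∀ i w → rot (rotN i w) ≡ rotN (suc i) w
  rot-rotN i w = trans (sym (rotN-+ i 1 w)) (cong (λ t → rotN t w) (NP.+-comm i 1))

  rotN-undo : ∀ i w → i ℕ.≤ suc k → rotN (suc k ∸ i) (rotN i w) ≡ w
  rotN-undo i w i≤ = trans (sym (rotN-+ i (suc k ∸ i) w))
    (trans (cong (λ t → rotN t w) (NP.m+[n∸m]≡n i≤)) (rotN-period w))

  rot-injective : ∀ {x y} → rot x ≡ rot y → x ≡ y
  rot-injective {a ∷ u} {b ∷ v} eq with VP.∷ʳ-injective u v eq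
  ... | refl , refl = refl

  rotN-injective : ∀ j {x y} → rotN j x ≡ rotN j y → x ≡ y
  rotN-injective zero    eq = eq
  rotN-injective (suc j) eq = rot-injective (rotN-injective j eq)

  ∈-rotN : ∀ j w {r} → r VM.∈ w → r VM.∈ rotN j w
  ∈-rotN zero    w       r∈ = r∈
  ∈-rotN (suc j) (a ∷ u) r∈ = ∈-rotN j (u ∷ʳ a) (∈-∷ʳ⁺ u r∈)

  ∈-rotN⁻ : ∀ j w {r} → j ℕ.≤ suc k → r VM.∈ rotN j w → r VM.∈ w
  ∈-rotN⁻ j w j≤ r∈ = subst (_ VM.∈_) (rotN-undo j w j≤) (∈-rotN (suc k ∸ j) (rotN j w) r∈)

  count-rotN : ∀ j w {P : A → Set} (P? : Decidable P) → count P? (rotN j w) ≡ count P? w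
  count-rotN zero    w       P? = refl
  count-rotN (suc j) (a ∷ u) P? = trans (count-rotN j (u ∷ʳ a) P?) (count-∷ʳ P? u a)

  toFront : ∀ {r} w → r VM.∈ w → Σ ℕ λ j → j ℕ.< suc k × rotN j w ≡ r ∷ tail (rotN j w)
  toFront {r} w r∈ with LMP.∈-∃++ (VMP.∈-toList⁺ r∈)
  ... | xs , ys , eq = length xs , bound , front (rotN (length xs) w) listEq
    where
    bound : length xs ℕ.< suc k
    bound = subst (length xs ℕ.<_)
      (trans (sym (LP.length-++ xs)) (trans (cong length (sym eq)) (VP.length-toList w)))
      (NP.m<m+n (length xs) (s≤s z≤n))
    listEq : toList (rotN (length xs) w) ≡ r ∷ (ys ++ xs)
    listEq = trans (toList-rotN (length xs) w) (trans (cong (rotLN (length xs)) eq) (rotLN-++ xs (r ∷ ys)))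
    front : ∀ {l} v → toList v ≡ r ∷ l → v ≡ r ∷ tail v
    front (a ∷ u) e = cong (_∷ u) (LP.∷-injectiveˡ e)

module _ {B : Set} where

  nth : B → List B → ℕ → B
  nth d []       _       = d
  nth d (x ∷ xs) zero    = x
  nth d (x ∷ xs) (suc i) = nth d xs i

  nth-∈ : ∀ d xs i → i ℕ.< length xs → nth d xs i LM.∈ xs
  nth-∈ d (x ∷ xs) zero    _         = LAny.here refl
  nth-∈ d (x ∷ xs) (suc i) (s≤s i<) = LAny.there (nth-∈ d xs i i<)

  ∈-nth : ∀ d {w} xs → w LM.∈ xs → Σ ℕ λ i → i ℕ.< length xs × nth d xs i ≡ w
  ∈-nth d (x ∷ xs) (LAny.here refl) = 0 , s≤s z≤n , refl
  ∈-nth d (x ∷ xs) (LAny.there w∈) with ∈-nth d xs w∈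
  ... | i , i< , eq = suc i , s≤s i< , eq

  nth-injective : ∀ d xs → Unique xs → ∀ i j → i ℕ.< length xs → j ℕ.< length xs →
                  nth d xs i ≡ nth d xs j → i ≡ j
  nth-injective d (x ∷ xs) _ zero zero _ _ _ = refl
  nth-injective d (x ∷ xs) (x∉ ∷ _) zero (suc j) _ (s≤s j<) eq =
    ⊥-elim (All.lookup x∉ (nth-∈ d xs j j<) eq)
  nth-injective d (x ∷ xs) (x∉ ∷ _) (suc i) zero (s≤s i<) _ eq =
    ⊥-elim (All.lookup x∉ (nth-∈ d xs i i<) (sym eq))
  nth-injective d (x ∷ xs) (_ ∷ u) (suc i) (suc j) (s≤s i<) (s≤s j<) eq =
    cong suc (nth-injective d xs u i j i< j< eq)

  Unique-resp-↭ : ∀ {xs ys : List B} → xs ↭ ys → Unique xs → Unique ys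
  Unique-resp-↭ p u = PS.Unique-resp-↭ (setoid B) (↭⇒↭ₛ p) u

%-+ˡ : ∀ a b N .{{_ : ℕ.NonZero N}} → ((a % N) + b) % N ≡ (a + b) % N
%-+ˡ a b N = trans (DM.%-distribˡ-+ (a % N) b N)
  (trans (cong (λ t → (t + b % N) % N) (DM.m%n%n≡m%n a N)) (sym (DM.%-distribˡ-+ a b N)))

module DeBruijn {A : Set} {k : ℕ} where

  W : Set
  W = Vec A (suc k)

  Follow : W → W → Set
  Follow e f = Σ A λ b → f ≡ tail e ∷ʳ b

  follow-rot : ∀ e → Follow e (rot e)
  follow-rot (a ∷ u) = a , refl

  -- Chain x zs y: the walk x, zs, y follows the edges of the graph.
  -- A closed trail through f is a chain from f via xs back to f with f ∷ xs unique.
  Chain : W → List W → W → Set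
  Chain x []       y = Follow x y
  Chain x (z ∷ zs) y = Follow x z × Chain z zs y

  chain-++ : ∀ {a b c} xs ys → Chain a xs b → Chain b ys c → Chain a (xs ++ b ∷ ys) c
  chain-++ []       ys p        q = p , q
  chain-++ (x ∷ xs) ys (p , ps) q = p , chain-++ xs ys ps q

  chain-split : ∀ {a b c} xs ys → Chain a (xs ++ b ∷ ys) c → Chain a xs b × Chain b ys c
  chain-split []       ys (p , q)  = p , q
  chain-split (x ∷ xs) ys (p , ps) with chain-split xs ys ps
  ... | q , r = (p , q) , r

  -- Siblings (words with the same tail) have the same successors.
  chain-sibling : ∀ {e f y} xs → tail e ≡ tail f → Chain f xs y → Chain e xs y
  chain-sibling []       eq (b , p)       = b , trans p (cong (_∷ʳ b) (sym eq))
  chain-sibling (x ∷ xs) eq ((b , p) , q) = (b , trans p (cong (_∷ʳ b) (sym eq))) , q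

  reanchor : ∀ f xs g → Chain f xs f → g LM.∈ (f ∷ xs) →
             Σ (List W) λ ys → Chain g ys g × ((g ∷ ys) ↭ (f ∷ xs))
  reanchor f xs g ch (LAny.here refl) = xs , ch , ↭-refl
  reanchor f xs g ch (LAny.there g∈) with LMP.∈-∃++ g∈
  ... | as , bs , refl with chain-split as bs ch
  ...   | c₁ , c₂ = bs ++ f ∷ as , chain-++ bs as c₂ c₁ , PP.++-comm (g ∷ bs) (f ∷ as)

  splice : ∀ {e f} ys xs → tail e ≡ tail f → Chain e ys e → Chain f xs f →
           Chain f (ys ++ e ∷ xs) f
  splice ys xs eq cₑ c_f = chain-++ ys xs (chain-sibling ys (sym eq) cₑ) (chain-sibling xs eq c_f)

  splice-↭ : ∀ (e f : W) ys xs → (f ∷ ys ++ e ∷ xs) ↭ ((e ∷ ys) ++ (f ∷ xs))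
  splice-↭ e f ys xs = ↭-trans (prep f (PP.shift e ys xs))
    (↭-trans (swap f e (↭-refl {x = ys ++ xs})) (prep e (↭-sym (PP.shift f ys xs))))

  rotations : W → ℕ → List W
  rotations x zero    = []
  rotations x (suc j) = rot x ∷ rotations (rot x) j

  chain-rotations : ∀ x j → Chain x (rotations x j) (rotN (suc j) x)
  chain-rotations x zero    = follow-rot x
  chain-rotations x (suc j) = follow-rot x , chain-rotations (rot x) j

  ∈-rotations⁻ : ∀ {u} x j → u LM.∈ rotations x j → Σ ℕ λ i → i ℕ.< j × u ≡ rotN (suc i) x
  ∈-rotations⁻ x (suc j) (LAny.here refl) = zero , s≤s z≤n , refl
  ∈-rotations⁻ x (suc j) (LAny.there u∈) with ∈-rotations⁻ (rot x) j u∈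
  ... | i , i<j , eq = suc i , s≤s i<j , eq

  ∈-rotations⁺ : ∀ x j i → i ℕ.< j → rotN (suc i) x LM.∈ rotations x j
  ∈-rotations⁺ x (suc j) zero    _         = LAny.here refl
  ∈-rotations⁺ x (suc j) (suc i) (s≤s i<j) = LAny.there (∈-rotations⁺ (rot x) j i i<j)

  rotations-unique : ∀ j y → (∀ a b → a ℕ.< b → b ℕ.≤ j → rotN a y ≢ rotN b y) →
                     Unique (y ∷ rotations y j)
  rotations-unique zero    y distinct = [] ∷ []
  rotations-unique (suc j) y distinct = All.tabulate y∉ ∷ rotations-unique j (rot y) shifted
    where
    y∉ : ∀ {u} → u LM.∈ rotations y (suc j) → y ≢ u
    y∉ u∈ eq with ∈-rotations⁻ y (suc j) u∈
    ... | i , i<j , e = distinct 0 (suc i) (s≤s z≤n) i<j (trans eq e)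
    shifted : ∀ a b → a ℕ.< b → b ℕ.≤ j → rotN a (rot y) ≢ rotN b (rot y)
    shifted a b a<b b≤j = distinct (suc a) (suc b) (s≤s a<b) (s≤s b≤j)

  record Orbit (w : W) : Set where
    field
      ys      : List W
      chain   : Chain w ys w
      unique  : Unique (w ∷ ys)
      members : ∀ {u} → u LM.∈ (w ∷ ys) → Σ ℕ λ i → i ℕ.≤ suc k × u ≡ rotN i w
      closed  : ∀ {u} → u LM.∈ (w ∷ ys) → rot u LM.∈ (w ∷ ys)

  -- With p = suc m the least period of w under rotation (p ≤ suc k), the
  -- orbit is w, rot w, …, rotᵐ w, and these words are pairwise distinct.
  orbit : DecidableEquality A → (w : W) → Orbit w
  orbit _≟_ w with leastBelow (λ i → rotN (suc i) w ≡ w)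
                              (λ i → VP.≡-dec _≟_ (rotN (suc i) w) w) (suc k)
  ... | inj₁ none = ⊥-elim (none k NP.≤-refl (rotN-period w))
  ... | inj₂ (m , m<1+k , period , minimal) = record
    { ys      = rotations w m
    ; chain   = subst (Chain w (rotations w m)) period (chain-rotations w m)
    ; unique  = rotations-unique m w distinct
    ; members = λ u∈ → let (i , i≤m , e) = members′ u∈ in i , NP.≤-trans i≤m (NP.<⇒≤ m<1+k) , e
    ; closed  = closed
    }
    where
    members′ : ∀ {u} → u LM.∈ (w ∷ rotations w m) → Σ ℕ λ i → i ℕ.≤ m × u ≡ rotN i w
    members′ (LAny.here refl) = 0 , z≤n , refl
    members′ (LAny.there u∈) with ∈-rotations⁻ w m u∈
    ... | i , i<m , e = suc i , i<m , e

    closed : ∀ {u} → u LM.∈ (w ∷ rotations w m) → rot u LM.∈ (w ∷ rotations w m)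
    closed u∈ with members′ u∈
    ... | i , i≤m , refl with NP.m≤n⇒m<n∨m≡n i≤m
    ...   | inj₁ i<m  = LAny.there (subst (LM._∈ rotations w m) (sym (rot-rotN i w))
                                          (∈-rotations⁺ w m i i<m))
    ...   | inj₂ refl = LAny.here (trans (rot-rotN i w) period)

    -- rotᵃ w ≡ rotᵇ w with a < b ≤ m would give the smaller period b ∸ a.
    distinct : ∀ a b → a ℕ.< b → b ℕ.≤ m → rotN a w ≢ rotN b w
    distinct a b a<b b≤m eq = minimal (b ∸ suc a) smaller (sym (rotN-injective a eq′))
      where
      c = suc (b ∸ suc a)
      a+c≡b : a + c ≡ b
      a+c≡b = trans (NP.+-suc a (b ∸ suc a)) (NP.m+[n∸m]≡n a<b)
      smaller : b ∸ suc a ℕ.< m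
      smaller = NP.≤-trans (subst (c ℕ.≤_) a+c≡b (NP.m≤n+m c a)) b≤m
      eq′ : rotN a w ≡ rotN a (rotN c w)
      eq′ = trans eq (trans (cong (λ t → rotN t w) (trans (sym a+c≡b) (NP.+-comm a c))) (rotN-+ c a w))

  chain-nth : ∀ d {a b} zs → Chain a zs b → ∀ i → i ℕ.< length zs →
              Follow (nth d (a ∷ zs) i) (nth d (a ∷ zs) (suc i))
  chain-nth d (z ∷ zs) (p , _) zero    _         = p
  chain-nth d (z ∷ zs) (_ , c) (suc i) (s≤s i<) = chain-nth d zs c i i<

  chain-last : ∀ d {a b} zs → Chain a zs b → Follow (nth d (a ∷ zs) (length zs)) b
  chain-last d []       p       = p
  chain-last d (z ∷ zs) (_ , c) = chain-last d zs c

  lookup-fz : ∀ (v : W) → V.lookup v fz ≡ head v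
  lookup-fz (a ∷ u) = refl

  lookup-fs : ∀ (v : W) (i : Fin k) → V.lookup v (fs i) ≡ V.lookup (tail v) i
  lookup-fs (a ∷ u) i = refl

  lookup-∷ʳ : ∀ {m} (u : Vec A m) b (i : Fin m) → V.lookup (u ∷ʳ b) (inject₁ i) ≡ V.lookup u i
  lookup-∷ʳ (x ∷ u) b fz     = refl
  lookup-∷ʳ (x ∷ u) b (fs i) = lookup-∷ʳ u b i

  module TrailCycle {f : W} {xs : List W} (trail : Chain f xs f) where

    N : ℕ
    N = suc (length xs)

    at : ℕ → W
    at a = nth f (f ∷ xs) (a % N)

    follows : ∀ b → b ℕ.< N → Follow (nth f (f ∷ xs) b) (nth f (f ∷ xs) (suc b % N))
    follows b (s≤s b≤) with NP.m≤n⇒m<n∨m≡n b≤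
    ... | inj₁ b<  = subst (λ t → Follow (nth f (f ∷ xs) b) (nth f (f ∷ xs) t))
                           (sym (DM.m<n⇒m%n≡m (s≤s b<))) (chain-nth f xs trail b b<)
    ... | inj₂ refl = subst (λ t → Follow (nth f (f ∷ xs) b) (nth f (f ∷ xs) t))
                            (sym (DM.n%n≡0 N)) (chain-last f xs trail)

    at-follows : ∀ a → Follow (at a) (at (suc a))
    at-follows a = subst (λ t → Follow (at a) (nth f (f ∷ xs) t)) suc-mod
                         (follows (a % N) (DM.m%n<n a N))
      where
      suc-mod : suc (a % N) % N ≡ suc a % N
      suc-mod = trans (cong (_% N) (NP.+-comm 1 (a % N)))
                      (trans (%-+ˡ a 1 N) (cong (_% N) (NP.+-comm a 1)))

    at-lookup : ∀ j (i : Fin (suc k)) → toℕ i ≡ j → ∀ a → V.lookup (at a) i ≡ head (at (a + j))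
    at-lookup zero    fz     _  a = trans (lookup-fz (at a)) (cong (λ t → head (at t)) (sym (NP.+-identityʳ a)))
    at-lookup zero    (fs i) ()
    at-lookup (suc j) fz     ()
    at-lookup (suc j) (fs i) eq a with at-follows a
    ... | b , next = begin
      V.lookup (at a) (fs i)                 ≡⟨ lookup-fs (at a) i ⟩
      V.lookup (tail (at a)) i               ≡⟨ sym (lookup-∷ʳ (tail (at a)) b i) ⟩
      V.lookup (tail (at a) ∷ʳ b) (inject₁ i) ≡⟨ cong (λ v → V.lookup v (inject₁ i)) (sym next) ⟩
      V.lookup (at (suc a)) (inject₁ i)      ≡⟨ at-lookup j (inject₁ i) (trans (FP.toℕ-inject₁ i) (NP.suc-injective eq)) (suc a) ⟩
      head (at (suc a + j))                  ≡⟨ cong (λ t → head (at t)) (sym (NP.+-suc a j)) ⟩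
      head (at (a + suc j))                  ∎
      where open ≡-Reasoning

    cycle : Fin N → A
    cycle i = head (nth f (f ∷ xs) (toℕ i))

    window-cycle : ∀ i → window (suc k) cycle i ≡ nth f (f ∷ xs) (toℕ i)
    window-cycle i = trans (VP.tabulate-cong letter) (trans (cong V.tabulate (cong V.lookup at-i)) (VP.tabulate∘lookup _))
      where
      at-i : at (toℕ i) ≡ nth f (f ∷ xs) (toℕ i)
      at-i = cong (nth f (f ∷ xs)) (DM.m<n⇒m%n≡m (FP.toℕ<n i))
      letter : ∀ j → cycle ((toℕ i + toℕ j) mod N) ≡ V.lookup (at (toℕ i)) j
      letter j = trans (cong (λ t → head (nth f (f ∷ xs) t)) (FP.toℕ-fromℕ< (DM.m%n<n (toℕ i + toℕ j) N)))
                       (sym (at-lookup (toℕ j) j refl (toℕ i)))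

    trail→universalCycle : (C : W → Set) → Unique (f ∷ xs) → (∀ {u} → u LM.∈ (f ∷ xs) → C u) →
                           (∀ w → C w → w LM.∈ (f ∷ xs)) → UCycle (suc k) C cycle
    trail→universalCycle C unique inC covers = inWindow , (λ {i} {j} → injective i j) , onto
      where
      inWindow : ∀ i → C (window (suc k) cycle i)
      inWindow i = subst C (sym (window-cycle i)) (inC (nth-∈ f (f ∷ xs) (toℕ i) (FP.toℕ<n i)))
      injective : ∀ i j → window (suc k) cycle i ≡ window (suc k) cycle j → i ≡ j
      injective i j eq = FP.toℕ-injective (nth-injective f (f ∷ xs) unique _ _ (FP.toℕ<n i) (FP.toℕ<n j)
                           (trans (sym (window-cycle i)) (trans eq (window-cycle j))))
      onto : ∀ w → C w → ∃ λ i → window (suc k) cycle i ≡ w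
      onto w cw with ∈-nth f (f ∷ xs) (covers w cw)
      ... | a , a<N , eq = F.fromℕ< a<N ,
        trans (window-cycle (F.fromℕ< a<N)) (trans (cong (nth f (f ∷ xs)) (FP.toℕ-fromℕ< a<N)) eq)

module CycleJoining {q k : ℕ}
  (C : Vec (Fin q) (suc k) → Set) (C? : ∀ w → Dec (C w))
  (C-rot : ∀ w → C w → C (rot w))
  (base : Vec (Fin q) (suc k)) (C-base : C base) where

  open DeBruijn {Fin q} {k}

  _≟W_ : DecidableEquality W
  _≟W_ = VP.≡-dec FP._≟_

  open import Data.List.Membership.DecPropositional _≟W_ using (_∈?_)

  C-rotN : ∀ j w → C w → C (rotN j w)
  C-rotN zero    w cw = cw
  C-rotN (suc j) w cw = C-rotN j (rot w) (C-rot w cw)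

  data Reachable : W → Set where
    reach-base    : Reachable base
    reach-rot     : ∀ {w} → Reachable (rot w) → Reachable w
    reach-sibling : ∀ {w w′} → C w′ → tail w ≡ tail w′ → Reachable w′ → Reachable w

  record Trail : Set where
    field
      f       : W
      xs      : List W
      chain   : Chain f xs f
      unique  : Unique (f ∷ xs)
      inC     : ∀ {u} → u LM.∈ (f ∷ xs) → C u
      closed  : ∀ {u} → u LM.∈ (f ∷ xs) → rot u LM.∈ (f ∷ xs)
      hasBase : base LM.∈ (f ∷ xs)

  words : Trail → List W
  words t = Trail.f t ∷ Trail.xs t

  closed-rotN : (t : Trail) → ∀ j {u} → u LM.∈ words t → rotN j u LM.∈ words t
  closed-rotN t zero    u∈ = u∈
  closed-rotN t (suc j) u∈ = closed-rotN t j (Trail.closed t u∈)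

  orbit-inC : ∀ {e} → C e → ∀ {u} → u LM.∈ (e ∷ Orbit.ys (orbit FP._≟_ e)) → C u
  orbit-inC {e} ce u∈ with Orbit.members (orbit FP._≟_ e) u∈
  ... | i , _ , refl = C-rotN i e ce

  initial : Trail
  initial = record
    { f = base ; xs = Orbit.ys O ; chain = Orbit.chain O ; unique = Orbit.unique O
    ; inC = orbit-inC C-base ; closed = Orbit.closed O ; hasBase = LAny.here refl }
    where O = orbit FP._≟_ base

  -- A reachable word of C outside a trail yields a word of C outside it
  -- that is a sibling of a word on it (the path from the base must cross).
  frontier : (t : Trail) → ∀ {e} → Reachable e → e LM.∉ words t → C e →
             Σ W λ e₁ → Σ W λ f₁ → e₁ LM.∉ words t × f₁ LM.∈ words t × tail e₁ ≡ tail f₁ × C e₁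
  frontier t reach-base e∉ _ = ⊥-elim (e∉ (Trail.hasBase t))
  frontier t {e} (reach-rot r) e∉ ce with rot e ∈? words t
  ... | yes re∈ = ⊥-elim (e∉ (subst (LM._∈ words t) (rotN-period e) (closed-rotN t k re∈)))
  ... | no re∉  = frontier t r re∉ (C-rot e ce)
  frontier t {e} (reach-sibling {w′ = w′} cw′ sib r) e∉ ce with w′ ∈? words t
  ... | yes w′∈ = e , w′ , e∉ , w′∈ , sib , ce
  ... | no w′∉  = frontier t r w′∉ cw′

  absorb : (t : Trail) → ∀ {e f′} → e LM.∉ words t → f′ LM.∈ words t → tail e ≡ tail f′ → C e →
           Σ Trail λ t′ → (∀ {x} → x LM.∈ words t → x LM.∈ words t′) × e LM.∈ words t′
  absorb t {e} {f′} e∉ f′∈ sib ce with reanchor (Trail.f t) (Trail.xs t) f′ (Trail.chain t) f′∈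
  ... | xs′ , chain′ , perm = t′ , (λ x∈ → fromParts (inj₂ x∈)) , fromParts (inj₁ (LAny.here refl))
    where
    O = orbit FP._≟_ e
    ys = Orbit.ys O
    new = f′ ∷ ys ++ e ∷ xs′
    parts : new ↭ ((e ∷ ys) ++ (f′ ∷ xs′))
    parts = splice-↭ e f′ ys xs′

    toParts : ∀ {x} → x LM.∈ new → x LM.∈ (e ∷ ys) ⊎ x LM.∈ words t
    toParts x∈ with LMP.∈-++⁻ (e ∷ ys) (PP.∈-resp-↭ parts x∈)
    ... | inj₁ x∈O = inj₁ x∈O
    ... | inj₂ x∈t = inj₂ (PP.∈-resp-↭ perm x∈t)

    fromParts : ∀ {x} → x LM.∈ (e ∷ ys) ⊎ x LM.∈ words t → x LM.∈ new
    fromParts (inj₁ x∈O) = PP.∈-resp-↭ (↭-sym parts) (LMP.∈-++⁺ˡ x∈O)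
    fromParts (inj₂ x∈t) = PP.∈-resp-↭ (↭-sym parts)
                             (LMP.∈-++⁺ʳ (e ∷ ys) (PP.∈-resp-↭ (↭-sym perm) x∈t))

    -- Since t is closed under rotation and e ∉ t, no rotation of e lies on t.
    disjoint : Disjoint (e ∷ ys) (f′ ∷ xs′)
    disjoint (v∈O , v∈t) with Orbit.members O v∈O
    ... | i , i≤ , refl = e∉ (subst (LM._∈ words t) (rotN-undo i e i≤)
                              (closed-rotN t (suc k ∸ i) (PP.∈-resp-↭ perm v∈t)))

    t′ : Trail
    t′ = record
      { f       = f′
      ; xs      = ys ++ e ∷ xs′
      ; chain   = splice ys xs′ sib (Orbit.chain O) chain′
      ; unique  = Unique-resp-↭ (↭-sym parts)
                    (UP.++⁺ (Orbit.unique O) (Unique-resp-↭ (↭-sym perm) (Trail.unique t)) disjoint)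
      ; inC     = λ x∈ → case toParts x∈ of λ where
                    (inj₁ x∈O) → orbit-inC ce x∈O
                    (inj₂ x∈t) → Trail.inC t x∈t
      ; closed  = λ x∈ → case toParts x∈ of λ where
                    (inj₁ x∈O) → fromParts (inj₁ (Orbit.closed O x∈O))
                    (inj₂ x∈t) → fromParts (inj₂ (Trail.closed t x∈t))
      ; hasBase = fromParts (inj₂ (Trail.hasBase t))
      }

  allVecs : ∀ m → List (Vec (Fin q) m)
  allVecs zero    = [ [] ]
  allVecs (suc m) = L.cartesianProductWith _∷_ (L.allFin q) (allVecs m)

  allVecs-complete : ∀ m (v : Vec (Fin q) m) → v LM.∈ allVecs m
  allVecs-complete zero    []      = LAny.here refl
  allVecs-complete (suc m) (a ∷ v) =
    LMP.∈-cartesianProductWith⁺ _∷_ (LMP.∈-allFin a) (allVecs-complete m v)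

  missing : List W → List W → ℕ
  missing ws []       = 0
  missing ws (x ∷ xs) with x ∈? ws
  ... | yes _ = missing ws xs
  ... | no _  = suc (missing ws xs)

  missing-mono : ∀ {ws ws′} → (∀ {x} → x LM.∈ ws → x LM.∈ ws′) → ∀ xs → missing ws′ xs ℕ.≤ missing ws xs
  missing-mono sub [] = z≤n
  missing-mono {ws} {ws′} sub (x ∷ xs) with x ∈? ws | x ∈? ws′
  ... | yes x∈ | yes _   = missing-mono sub xs
  ... | yes x∈ | no x∉′  = ⊥-elim (x∉′ (sub x∈))
  ... | no _   | yes _   = NP.m≤n⇒m≤1+n (missing-mono sub xs)
  ... | no _   | no _    = s≤s (missing-mono sub xs)

  missing-strict : ∀ {ws ws′ e} → (∀ {x} → x LM.∈ ws → x LM.∈ ws′) → e LM.∉ ws → e LM.∈ ws′ →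
                   ∀ xs → e LM.∈ xs → missing ws′ xs ℕ.< missing ws xs
  missing-strict {ws} {ws′} sub e∉ e∈ (x ∷ xs) (LAny.here refl) with x ∈? ws | x ∈? ws′
  ... | yes x∈ | _      = ⊥-elim (e∉ x∈)
  ... | no _   | no x∉′ = ⊥-elim (x∉′ e∈)
  ... | no _   | yes _  = s≤s (missing-mono sub xs)
  missing-strict {ws} {ws′} sub e∉ e∈ (x ∷ xs) (LAny.there e∈xs) with x ∈? ws | x ∈? ws′
  ... | yes _  | yes _  = missing-strict sub e∉ e∈ xs e∈xs
  ... | yes x∈ | no x∉′ = ⊥-elim (x∉′ (sub x∈))
  ... | no _   | yes _  = NP.m≤n⇒m≤1+n (missing-strict sub e∉ e∈ xs e∈xs)
  ... | no _   | no _   = s≤s (missing-strict sub e∉ e∈ xs e∈xs)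

  module _ (reachable : ∀ w → C w → Reachable w) where

    -- Absorb orbits until no word of C is missing; the number of words
    -- missing from the trail strictly decreases, so fuel ≥ that number suffices.
    grow : ∀ fuel (t : Trail) → missing (words t) (allVecs (suc k)) ℕ.≤ fuel →
           Σ Trail λ t → ∀ w → C w → w LM.∈ words t
    grow fuel t bound with LAny.any? (λ w → C? w ×-dec ¬? (w ∈? words t)) (allVecs (suc k))
    ... | no none = t , covers
      where
      covers : ∀ w → C w → w LM.∈ words t
      covers w cw with w ∈? words t
      ... | yes w∈ = w∈
      ... | no w∉  = ⊥-elim (none (LAny.map (λ { refl → cw , w∉ }) (allVecs-complete (suc k) w)))
    ... | yes some with LAny.satisfied some
    ...   | e , ce , e∉ with frontier t (reachable e ce) e∉ ce
    ...     | e₁ , f₁ , e₁∉ , f₁∈ , sib , ce₁ with absorb t e₁∉ f₁∈ sib ce₁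
    ...       | t′ , grows , e₁∈ = continue fuel bound
                  (missing-strict grows e₁∉ e₁∈ (allVecs (suc k)) (allVecs-complete (suc k) e₁))
      where
      continue : ∀ fuel → missing (words t) (allVecs (suc k)) ℕ.≤ fuel →
                 missing (words t′) (allVecs (suc k)) ℕ.< missing (words t) (allVecs (suc k)) →
                 Σ Trail λ t → ∀ w → C w → w LM.∈ words t
      continue zero       b lt = ⊥-elim (NP.n≮0 (NP.<-≤-trans lt b))
      continue (suc fuel) b lt = grow fuel t′ (NP.≤-pred (NP.≤-trans lt b))

    cycleJoining : Σ ℕ λ M → Σ (Fin (suc M) → Fin q) λ x → UCycle (suc k) C x
    cycleJoining with grow _ initial NP.≤-refl
    ... | t , covers = length (Trail.xs t) , TrailCycle.cycle (Trail.chain t) ,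
      TrailCycle.trail→universalCycle (Trail.chain t) C (Trail.unique t) (Trail.inC t) covers

module Rankings (k : ℕ) where

  open import Data.Vec.Membership.DecPropositional (FP._≟_ {suc k}) using () renaming (_∈?_ to _∈V?_)

  -- Legality only depends on membership and counts, so it is rotation invariant.
  legal-rot⁻ : (w : Word (suc k)) → Legal (rot w) → Legal w
  legal-rot⁻ (a ∷ u) lg r r∈ = trans (sym (count-∷ʳ (F._<? r) u a)) (lg r (∈-∷ʳ⁺ u r∈))

  illegal-rot : (w : Word (suc k)) → Illegal w → Illegal (rot w)
  illegal-rot w il lg = il (legal-rot⁻ w lg)

  legal? : (w : Word (suc k)) → Dec (Legal w)
  legal? w = FP.all? λ r → (r ∈V? w) →-dec (count (F._<? r) w NP.≟ toℕ r)

  illegal? : (w : Word (suc k)) → Dec (Illegal w)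
  illegal? w = ¬? (legal? w)

  top : Fin (suc k)
  top = fromℕ k

  nothing-above-top : ∀ (r : Fin (suc k)) → ¬ (top F.< r)
  nothing-above-top r lt = NP.<-irrefl refl
    (NP.<-≤-trans (subst (ℕ._< toℕ r) (FP.toℕ-fromℕ k) lt) (FP.toℕ≤pred[n] r))

  first-below : ∀ {r : Fin (suc k)} → r ≢ fz → fz {k} F.< r
  first-below {fz}   r≢1 = ⊥-elim (r≢1 refl)
  first-below {fs r} _   = s≤s z≤n

  -- A tie for the last place is illegal: fewer than k letters lie below top.
  top-tie-illegal : (v : Vec (Fin (suc k)) k) → top VM.∈ v → Illegal (top ∷ v)
  top-tie-illegal v top∈ lg = NP.<-irrefl below (count<length (F._<? top) v top∈ (FP.<-irrefl refl))
    where
    below : count (F._<? top) v ≡ k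
    below = trans (sym (count-no (F._<? top) top v (FP.<-irrefl refl)))
                  (trans (lg top (here refl)) (FP.toℕ-fromℕ k))

  -- Every legal ranking awards the first place: below any occurring letter
  -- r ≠ 1 lie toℕ r > 0 letters, so a smaller letter occurs.
  legal-has-first : (v : Word (suc k)) → Legal v → fz VM.∈ v
  legal-has-first (a ∷ u) lg = descend (suc k) a (FP.toℕ<n a) (here refl)
    where
    descend : ∀ b (r : Fin (suc k)) → toℕ r ℕ.< b → r VM.∈ (a ∷ u) → fz VM.∈ (a ∷ u)
    descend (suc b) fz     _        r∈ = r∈
    descend (suc b) (fs r) (s≤s r<) r∈
      with count-witness (F._<? fs r) (a ∷ u) (subst (0 ℕ.<_) (sym (lg (fs r) r∈)) (s≤s z≤n))
    ... | x , x∈ , x<r = descend b x (NP.≤-trans x<r r<) x∈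

module IllegalRankings (k : ℕ) where

  open Rankings (suc k) public
  open import Data.Vec.Membership.DecPropositional (FP._≟_ {suc (suc k)}) using () renaming (_∈?_ to _∈V?_)

  n : ℕ
  n = suc (suc k)

  allTop : Word n
  allTop = replicate n top

  open CycleJoining Illegal illegal? illegal-rot allTop
                    (top-tie-illegal (replicate (suc k) top) (here refl)) public

  reach-rotN : ∀ j w → Reachable (rotN j w) → Reachable w
  reach-rotN zero    w r = r
  reach-rotN (suc j) w r = reach-rot (reach-rotN j (rot w) r)

  -- If the letters after the prefix us are all top, replace the first letter
  -- by top (an illegal sibling, as top occurs later) and rotate it to the end;
  -- repeating this reaches allTop.
  reach-topSuffix : ∀ us i (w : Word n) → toList w ≡ us ++ L.replicate (suc i) top → Reachable w
  reach-topSuffix [] i w eq = subst Reachable (sym w≡allTop) reach-base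
    where
    len : suc i ≡ n
    len = trans (sym (LP.length-replicate (suc i))) (trans (cong length (sym eq)) (VP.length-toList w))
    w≡allTop : w ≡ allTop
    w≡allTop = toList-injective (trans eq (trans (cong (λ j → L.replicate j top) len)
                                                 (sym (VP.toList-replicate n top))))
  reach-topSuffix (x ∷ us) i (a ∷ v) eq =
    reach-sibling illegal refl (reach-rot (reach-topSuffix us (suc i) (v ∷ʳ top) eq′))
    where
    tail-list : toList v ≡ us ++ L.replicate (suc i) top
    tail-list = LP.∷-injectiveʳ eq
    illegal : Illegal (top ∷ v)
    illegal = top-tie-illegal v (VMP.∈-toList⁻ (subst (top LM.∈_) (sym tail-list)
                                                      (LMP.∈-++⁺ʳ us (LAny.here refl))))
    eq′ : toList (v ∷ʳ top) ≡ us ++ L.replicate (suc (suc i)) top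
    eq′ = begin
      toList (v ∷ʳ top)                           ≡⟨ VP.toList-∷ʳ top v ⟩
      toList v ++ [ top ]                         ≡⟨ cong (_++ [ top ]) tail-list ⟩
      (us ++ L.replicate (suc i) top) ++ [ top ]  ≡⟨ LP.++-assoc us _ [ top ] ⟩
      us ++ L.replicate (suc i) top ++ [ top ]    ≡⟨ cong (us ++_) (replicate-∷ʳ (suc i) top) ⟩
      us ++ L.replicate (suc (suc i)) top         ∎
      where open ≡-Reasoning

  -- A word containing top is reachable: rotate it so that top comes last.
  reach-withTop : ∀ w → top VM.∈ w → Reachable w
  reach-withTop w top∈ with LMP.∈-∃++ (VMP.∈-toList⁺ top∈)
  ... | us , vs , eq = reach-rotN (length (us ++ [ top ])) w (reach-topSuffix (vs ++ us) 0 (rotN (length (us ++ [ top ])) w) rotated)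
    where
    rotated : toList (rotN (length (us ++ [ top ])) w) ≡ (vs ++ us) ++ [ top ]
    rotated = begin
      toList (rotN (length (us ++ [ top ])) w)               ≡⟨ toList-rotN (length (us ++ [ top ])) w ⟩
      rotLN (length (us ++ [ top ])) (toList w)              ≡⟨ cong (rotLN (length (us ++ [ top ]))) (trans eq (sym (LP.++-assoc us [ top ] vs))) ⟩
      rotLN (length (us ++ [ top ])) ((us ++ [ top ]) ++ vs) ≡⟨ rotLN-++ (us ++ [ top ]) vs ⟩
      vs ++ us ++ [ top ]                                    ≡⟨ sym (LP.++-assoc vs us [ top ]) ⟩
      (vs ++ us) ++ [ top ]                                  ∎
      where open ≡-Reasoning

  -- A word w without top such that replacing the first letter of any rotation
  -- by top gives a legal ranking.  Then w is a rotation of M 1 1 … 1.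
  module ForcedShape (w : Word n) (iw : Illegal w) (top∉ : ¬ top VM.∈ w)
                     (top-heads-legal : ∀ j → j ℕ.< n → Legal (top ∷ tail (rotN j w))) where

    count-tail : ∀ j → j ℕ.< n → ∀ r → r VM.∈ tail (rotN j w) → count (F._<? r) (tail (rotN j w)) ≡ toℕ r
    count-tail j j< r r∈ = trans (sym (count-no (F._<? r) top (tail (rotN j w)) (nothing-above-top r)))
                                 (top-heads-legal j j< r (there r∈))

    first∈w : fz VM.∈ w
    first∈w = ∈-tail w (top-first (legal-has-first _ (top-heads-legal 0 (s≤s z≤n))))
      where
      top-first : fz VM.∈ (top ∷ tail w) → fz VM.∈ tail w
      top-first (here ())
      top-first (there fz∈) = fz∈

    -- Rotating 1 to the front: below a letter r ≠ 1 lie that 1 and toℕ r others.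
    count-w : ∀ r → r VM.∈ w → r ≢ fz → count (F._<? r) w ≡ suc (toℕ r)
    count-w r r∈ r≢1 with toFront w first∈w
    ... | j , j< , e with subst (r VM.∈_) e (∈-rotN j w r∈)
    ...   | here r≡1  = ⊥-elim (r≢1 r≡1)
    ...   | there r∈u = begin
      count (F._<? r) w                         ≡⟨ sym (count-rotN j w (F._<? r)) ⟩
      count (F._<? r) (rotN j w)                ≡⟨ cong (count (F._<? r)) e ⟩
      count (F._<? r) (fz ∷ tail (rotN j w))    ≡⟨ count-yes (F._<? r) fz (tail (rotN j w)) (first-below r≢1) ⟩
      suc (count (F._<? r) (tail (rotN j w)))   ≡⟨ cong suc (count-tail j j< r r∈u) ⟩
      suc (toℕ r)                               ∎
      where open ≡-Reasoning

    -- The first letter of any rotation lies below every later letter r ≠ 1: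
    -- otherwise only toℕ r letters of w would lie below r.
    head-below : ∀ j a → j ℕ.< n → rotN j w ≡ a ∷ tail (rotN j w) →
                 ∀ r → r VM.∈ tail (rotN j w) → r ≢ fz → a F.< r
    head-below j a j< e r r∈ r≢1 with a F.<? r
    ... | yes a<r = a<r
    ... | no a≮r  = ⊥-elim (NP.1+n≢n (begin
      suc (toℕ r)                            ≡⟨ sym (count-w r (∈-rotN⁻ j w (NP.<⇒≤ j<) (∈-tail (rotN j w) r∈)) r≢1) ⟩
      count (F._<? r) w                      ≡⟨ sym (count-rotN j w (F._<? r)) ⟩
      count (F._<? r) (rotN j w)             ≡⟨ cong (count (F._<? r)) e ⟩
      count (F._<? r) (a ∷ tail (rotN j w))  ≡⟨ count-no (F._<? r) a (tail (rotN j w)) a≮r ⟩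
      count (F._<? r) (tail (rotN j w))      ≡⟨ count-tail j j< r r∈ ⟩
      toℕ r                                  ∎))
      where open ≡-Reasoning

    -- Rotating a letter M ≠ 1 to the front, every later letter r ≠ 1 would
    -- satisfy both M < r and r < M; so all later letters are 1.
    forcedShape : Σ ℕ λ j → Σ (Fin n) λ M → rotN j w ≡ M ∷ replicate (suc k) fz × M ≢ fz × M ≢ top
    forcedShape with VAny.any? (λ x → ¬? (x FP.≟ fz)) w
    ... | no ¬some = ⊥-elim (iw only-first-legal)
      where
      only-first-legal : Legal w
      only-first-legal r r∈ with r FP.≟ fz
      ... | yes refl = count-none (F._<? fz {suc k}) w (λ x _ ())
      ... | no r≢1   = ⊥-elim (¬some (VMP.toAny r∈ r≢1))
    ... | yes some with VMP.fromAny some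
    ...   | M , M∈ , M≢1 with toFront w M∈
    ...     | j , j< , e = j , M , trans e (cong (M ∷_) (all-equal⇒replicate fz _ rest-first)) ,
                           M≢1 , (λ M≡top → top∉ (subst (VM._∈ w) M≡top M∈))
      where
      rest-first : ∀ r → r VM.∈ tail (rotN j w) → r ≡ fz
      rest-first r r∈ with r FP.≟ fz
      ... | yes r≡1 = r≡1
      ... | no r≢1 with toFront w (∈-rotN⁻ j w (NP.<⇒≤ j<) (∈-tail (rotN j w) r∈))
      ...   | j′ , j′< , e′ with subst (M VM.∈_) e′ (∈-rotN j′ w M∈)
      ...     | here M≡r  = ⊥-elim (FP.<⇒≢ (head-below j M j< e r r∈ r≢1) M≡r)
      ...     | there M∈′ = ⊥-elim (FP.<-asym (head-below j M j< e r r∈ r≢1)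
                                               (head-below j′ r j′< e′ M M∈′ M≢1))

  reachable-from-shapes : (∀ M → M ≢ fz → M ≢ top → Reachable (M ∷ replicate (suc k) fz)) →
                          ∀ w → Illegal w → Reachable w
  reachable-from-shapes shapes w iw with top ∈V? w
  ... | yes top∈ = reach-withTop w top∈
  ... | no top∉ with FP.any? (λ j → illegal? (top ∷ tail (rotN (toℕ j) w)))
  ...   | yes (j , il) = reach-rotN (toℕ j) w (reach-sibling il refl (reach-withTop _ (here refl)))
  ...   | no none with ForcedShape.forcedShape w iw top∉ top-heads-legal
    where
    top-heads-legal : ∀ j → j ℕ.< n → Legal (top ∷ tail (rotN j w))
    top-heads-legal j j< with legal? (top ∷ tail (rotN j w))
    ... | yes lg = lg
    ... | no il  = ⊥-elim (none (F.fromℕ< j< , subst (λ t → Illegal (top ∷ tail (rotN t w)))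
                                                     (sym (FP.toℕ-fromℕ< j<)) il))
  ...   | j , M , e , M≢1 , M≢top = reach-rotN j w (subst Reachable (sym e) (shapes M M≢1 M≢top))

-- For n = 2 there is no letter besides 1 and top, so there is nothing to reach.
shapes-2 : ∀ (M : Fin 2) → M ≢ fz → M ≢ IllegalRankings.top 0 →
           IllegalRankings.Reachable 0 (M ∷ replicate 1 fz)
shapes-2 fz      M≢1 _     = ⊥-elim (M≢1 refl)
shapes-2 (fs fz) _   M≢top = ⊥-elim (M≢top refl)

-- For n = k + 4, M 1 1 … 1 has the illegal sibling 2 1 1 … 1, whose rotation
-- 1 1 … 1 2 has the illegal sibling top 1 … 1 2, which contains top.  Both
-- siblings are illegal because more than one letter 1 lies below the letter 2
-- (for n = 3 the second one, 3 1 2, is legal).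
module LongRankings (k : ℕ) where

  open IllegalRankings (suc (suc k))

  second : Fin n
  second = fs fz

  ones : ∀ m → Vec (Fin n) m
  ones m = replicate m fz

  ones-below-second : ∀ m → count (F._<? second) (ones m) ≡ m
  ones-below-second zero    = refl
  ones-below-second (suc m) = trans (count-yes (F._<? second) fz (ones m) (s≤s z≤n))
                                    (cong suc (ones-below-second m))

  second≮second : ¬ second F.< second
  second≮second = FP.<-irrefl {n = n} refl

  second-ones-illegal : Illegal (second ∷ ones (suc (suc (suc k))))
  second-ones-illegal lg with begin
    suc (suc (suc k))                                      ≡⟨ sym (ones-below-second (suc (suc (suc k)))) ⟩
    count (F._<? second) (ones (suc (suc (suc k))))        ≡⟨ sym (count-no (F._<? second) second (ones (suc (suc (suc k)))) second≮second) ⟩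
    count (F._<? second) (second ∷ ones (suc (suc (suc k)))) ≡⟨ lg second (here refl) ⟩
    1                                                      ∎
    where open ≡-Reasoning
  ... | ()

  top-ones-second-illegal : Illegal (top ∷ (ones (suc (suc k)) ∷ʳ second))
  top-ones-second-illegal lg with begin
    suc (suc k)                                             ≡⟨ sym (ones-below-second (suc (suc k))) ⟩
    count (F._<? second) (ones (suc (suc k)))               ≡⟨ sym (count-no (F._<? second) second (ones (suc (suc k))) second≮second) ⟩
    count (F._<? second) (second ∷ ones (suc (suc k)))      ≡⟨ sym (count-∷ʳ (F._<? second) (ones (suc (suc k))) second) ⟩
    count (F._<? second) (ones (suc (suc k)) ∷ʳ second)     ≡⟨ sym (count-no (F._<? second) top (ones (suc (suc k)) ∷ʳ second) (nothing-above-top second)) ⟩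
    count (F._<? second) (top ∷ (ones (suc (suc k)) ∷ʳ second)) ≡⟨ lg second (there (∈-∷ʳ⁺ (ones (suc (suc k))) (here refl))) ⟩
    1                                                       ∎
    where open ≡-Reasoning
  ... | ()

  shapes : ∀ M → M ≢ fz → M ≢ top → Reachable (M ∷ ones (suc (suc (suc k))))
  shapes M _ _ = reach-sibling second-ones-illegal refl
                   (reach-rot (reach-sibling top-ones-second-illegal refl (reach-withTop (top ∷ (ones (suc (suc k)) ∷ʳ second)) (here refl))))

theorem7 : (n : ℕ) → ¬ n ≡ 0 → ¬ n ≡ 1 → ¬ n ≡ 3 →
    Σ ℕ λ M → Σ (Fin (suc M) → Fin n) λ x → UCycle n (Illegal {n}) x
theorem7 zero                       n≢0 _   _   = ⊥-elim (n≢0 refl)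
theorem7 (suc zero)                 _   n≢1 _   = ⊥-elim (n≢1 refl)
theorem7 (suc (suc zero))           _   _   _   =
  IllegalRankings.cycleJoining 0 (IllegalRankings.reachable-from-shapes 0 shapes-2)
theorem7 (suc (suc (suc zero)))     _   _   n≢3 = ⊥-elim (n≢3 refl)
theorem7 (suc (suc (suc (suc k)))) _   _   _   =
  IllegalRankings.cycleJoining (suc (suc k))
    (IllegalRankings.reachable-from-shapes (suc (suc k)) (LongRankings.shapes k))
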